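{- Let $d\ge 1$ be an integer and let $G_1,\dots,G_r$ be all the connected graphs (up to isomorphism) having between $1$ and $d$ edges. Then there exist finite simple graphs $T$ and $U$, each with at most $(d+1)(2^d-1)$ edges, which are not isomorphic (even after discarding isolated vertices) and which cannot be separated by $I(G_1),\dots,I(G_r)$, i.e. $I(G_i)(T)=I(G_i)(U)$ for all $i=1,\dots,r$.
   Context: All graphs are finite simple graphs (undirected, no loops, no multiple edges), considered up to isomorphism and up to adding or deleting isolated vertices. For graphs $G,H$, $I(G)(H)$ denotes the number of subsets $F$ of the edge set of $H$ such that the graph formed by the edges in $F$ (together with their endpoints) is isomorphic to $G$ (ignoring isolated vertices of $G$). The degree of a graph is its number of edges. A graph is connected here if it has at least one edge and its edges (with their endpoints) form a connected graph. -}

module Defs where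

open import Data.Bool using (Bool; true; false; _∧_; _∨_; if_then_else_; T)
open import Data.Nat using (ℕ; zero; suc; _<ᵇ_)
open import Data.Fin using (Fin; toℕ; _≟_)
open import Data.Fin.Base using ()
open import Data.Product using (Σ; _×_; _,_; proj₁; ∃)
open import Data.List using (List; []; _∷_; [_]; concatMap; length; zip; allFin)
open import Data.Bool.ListAction using (any)
open import Data.List.Membership.Propositional using (_∈_)
open import Data.List.Relation.Unary.Unique.Propositional using (Unique)
open import Data.Vec using (Vec; toList)
open import Relation.Nullary.Decidable using (⌊_⌋)
open import Relation.Binary.PropositionalEquality using (_≡_)
open import Function.Bundles using (_↔_; _⇔_; Inverse)

-- The edge {i,j} (i ≠ j) is present
-- iff e i j ≡ true where i < j; the entries e i j with i ≥ j are ignored.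
-- So loops and multiple edges are impossible by construction.
record Graph : Set where
  constructor graph
  field
    n : ℕ
    e : Fin n → Fin n → Bool

open Graph public

adj : (G : Graph) → Fin (n G) → Fin (n G) → Bool
adj G i j =
  if toℕ i <ᵇ toℕ j then e G i j
  else (if toℕ j <ᵇ toℕ i then e G j i else false)

anyᶠ : ∀ {m} → (Fin m → Bool) → Bool
anyᶠ {zero} f = false
anyᶠ {suc m} f = f Fin.zero ∨ anyᶠ (λ i → f (Fin.suc i))

hasNbr : (G : Graph) → Fin (n G) → Bool
hasNbr G i = anyᶠ (adj G i)

NV : Graph → Set
NV G = Σ (Fin (n G)) (λ i → T (hasNbr G i))

_≅_ : Graph → Graph → Set
G ≅ H = Σ (NV G ↔ NV H) λ φ →
  ∀ u v → adj H (proj₁ (Inverse.to φ u)) (proj₁ (Inverse.to φ v)) ≡ adj G (proj₁ u) (proj₁ v)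

edgeList : (G : Graph) → List (Fin (n G) × Fin (n G))
edgeList G = concatMap (λ i → concatMap (λ j →
  if (toℕ i <ᵇ toℕ j) ∧ e G i j then [ (i , j) ] else []) (allFin (n G))) (allFin (n G))

numEdges : Graph → ℕ
numEdges G = length (edgeList G)

-- subsets F of the edge set of H, encoded as characteristic vectors over edgeList H
EdgeSubset : Graph → Set
EdgeSubset H = Vec Bool (numEdges H)

-- the graph formed by the edges in F (on the vertex set of H; extra isolated
-- vertices are irrelevant since ≅ ignores isolated vertices)
subgraph : (H : Graph) → EdgeSubset H → Graph
subgraph H F = graph (n H) λ i j →
  any (λ { ((a , b) , bit) → bit ∧ ⌊ a ≟ i ⌋ ∧ ⌊ b ≟ j ⌋ }) (zip (edgeList H) (toList F))

-- I(G)(H) ≡ k : there are exactly k subsets F of E(H) whose graph is ≅ G,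
-- expressed as: some duplicate-free list of length k enumerates exactly them.
ICount : Graph → Graph → ℕ → Set
ICount G H k = ∃ λ (xs : List (EdgeSubset H)) →
  Unique xs × length xs ≡ k × (∀ F → (F ∈ xs) ⇔ (subgraph H F ≅ G))

data Reach (G : Graph) : Fin (n G) → Fin (n G) → Set where
  here : ∀ {u} → Reach G u u
  step : ∀ {u v w} → T (adj G u v) → Reach G v w → Reach G u w

Connected : Graph → Set
Connected G = (1 Data.Nat.≤ numEdges G) × (∀ (u v : NV G) → Reach G (proj₁ u) (proj₁ v))

-- For d ≥ 2 take T = 2 C_{d+1} and U = C_{2d+2}. Both are 2-lifts of the cycle C_{d+1}: T is the
-- untwisted lift and U the lift twisted on one edge. Give each edge of a lift the class of the base
-- edge below it. A copy of a graph with at most d edges in T or U misses one of the d + 1 classes,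
-- say c; switching the sheets over the arc {0, …, c} of the base cycle moves the twist onto the
-- edge of class c, and so maps the copy onto an isomorphic copy in the other lift. Always using the
-- first missed class makes this a bijection between copies, so all counts agree, while T is
-- disconnected and U is connected. For d = 1 the pair 2K₂, P₃ works the same way with two classes.

module Submission where

open import Defs
open import Algebra.Bundles using (CommutativeRing)
open import Data.Bool using (Bool; true; false; _∧_; _∨_; _xor_; not; if_then_else_; T)
open import Data.Bool.ListAction using (any)
open import Data.Bool.Properties
  using (T-irrelevant; T?; T-≡; T-not-≡; T-∧; T-∨; ∧-identityʳ; ∧-zeroʳ; ∨-identityʳ; ∨-comm;
         xor-assoc; xor-comm; xor-same; xor-identityʳ; xor-∧-commutativeRing)
  renaming (_≟_ to _≟ᵇ_)
open import Data.Empty using (⊥-elim)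
open import Data.Fin using (Fin; toℕ; fromℕ; fromℕ<; _≟_; splitAt; join) renaming (zero to fzero; suc to fsuc)
open import Data.Fin.Properties
  using (toℕ-injective; any?; all?; injective⇒≤; splitAt-join; join-splitAt; toℕ-fromℕ; toℕ-fromℕ<; toℕ<n; toℕ≤pred[n])
open import Data.List
  using (List; []; _∷_; [_]; concatMap; length; lookup; zip; allFin; map; filter; cartesianProductWith)
open import Data.List.Membership.Propositional using (_∈_; _∉_)
open import Data.List.Membership.Propositional.Properties
  using (∈-concatMap⁺; ∈-concatMap⁻; ∈-allFin; ∈-cartesianProductWith⁺; ∈-filter⁺; ∈-filter⁻; ∈-map⁺; ∈-map⁻)
open import Data.List.Properties using (length-map; length-++; length-tabulate; map-∘; map-id-local)
open import Data.List.Relation.Unary.All as All using (All; []; _∷_)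
open import Data.List.Relation.Unary.All.Properties using (All¬⇒¬Any)
open import Data.List.Relation.Unary.Any as Any using (Any; here; there)
open import Data.List.Relation.Unary.Any.Properties using (lookup-index)
open import Data.List.Relation.Unary.Unique.Propositional using (Unique; []; _∷_)
open import Data.List.Relation.Unary.Unique.Propositional.Properties
  using (++⁺; allFin⁺; cartesianProductWith⁺; filter⁺; map⁻)
open import Data.Maybe using (Maybe; just; nothing; maybe′)
import Data.Maybe as Maybe
open import Data.Nat using (ℕ; zero; suc; _<ᵇ_; _≤ᵇ_; _≡ᵇ_; _<_; _≤_; _≤?_; z≤n; s≤s; _+_; _*_; _^_; _∸_)
open import Data.Nat.Properties
  using (<ᵇ⇒<; <⇒<ᵇ; ≤ᵇ⇒≤; ≡ᵇ⇒≡; ≡⇒≡ᵇ; <-irrefl; <-asym; <-cmp; <-trans; n<1+n; n≤1+n; m≤n+m; <⇒≱; ≤∧≢⇒<;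
         ≤-trans; ≤-reflexive; +-mono-≤; *-monoʳ-≤; +-identityʳ; *-identityʳ; m+n≤o⇒m≤o∸n; 1+n≢n; suc-injective;
         module ≤-Reasoning)
open import Data.Nat.Tactic.RingSolver using (solve-∀)
open import Data.Product using (Σ; _×_; _,_; proj₁; proj₂; ∃)
open import Data.Sum using (_⊎_; inj₁; inj₂; swap; reduce)
open import Data.Vec using (Vec; []; _∷_; toList; replicate)
open import Data.Vec.Functional using () renaming (_∷_ to _∷ᶠ_)
open import Data.Vec.Properties using (∷-injective)
open import Function using (_∘_)
open import Function.Bundles using (_⇔_; Inverse; Injection; Equivalence; mk↔ₛ′; mk⇔)
open import Function.Properties.Inverse using (↔⇒↣)
open import Relation.Binary using (tri<; tri≈; tri>)
open import Relation.Binary.PropositionalEquality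
  using (_≡_; _≢_; refl; sym; trans; cong; cong₂; subst; module ≡-Reasoning)
open import Relation.Nullary using (¬_; Dec; yes; no)
open import Relation.Nullary.Decidable using (True; _×-dec_; _→-dec_; ¬?; ⌊_⌋; toWitness; fromWitness)

<ᵇ-true : ∀ {m n} → m < n → (m <ᵇ n) ≡ true
<ᵇ-true = Equivalence.to T-≡ ∘ <⇒<ᵇ

<ᵇ-false : ∀ {m n} → ¬ m < n → (m <ᵇ n) ≡ false
<ᵇ-false {m} {n} m≮n with m <ᵇ n in eq
... | false = refl
... | true  = ⊥-elim (m≮n (<ᵇ⇒< m n (Equivalence.from T-≡ eq)))

T-ext : ∀ {a b} → (T a → T b) → (T b → T a) → a ≡ b
T-ext {false} {false} _ _ = refl
T-ext {false} {true}  _ g = ⊥-elim (g _)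
T-ext {true}  {false} f _ = ⊥-elim (f _)
T-ext {true}  {true}  _ _ = refl

∧-absorbˡ : ∀ a b → (T b → T a) → (a ∧ b) ≡ b
∧-absorbˡ a false _     = ∧-zeroʳ a
∧-absorbˡ a true  b⇒a = cong (_∧ true) (Equivalence.to T-≡ (b⇒a _))

∧-congˡ-guarded : ∀ a {b b′} → (T a → b ≡ b′) → (a ∧ b) ≡ (a ∧ b′)
∧-congˡ-guarded false _   = refl
∧-congˡ-guarded true  b≡b′ = b≡b′ _

xor-interchange : ∀ a b c d → ((a xor b) xor (c xor d)) ≡ ((a xor c) xor (b xor d))
xor-interchange = interchange
  where open import Algebra.Properties.CommutativeSemigroup
          (CommutativeRing.+-commutativeSemigroup xor-∧-commutativeRing)

xor-cancelʳ : ∀ a b → ((a xor b) xor b) ≡ a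
xor-cancelʳ a b = trans (xor-assoc a b b) (trans (cong (a xor_) (xor-same b)) (xor-identityʳ a))

xor-cancelˡ : ∀ a b → ((a xor b) xor a) ≡ b
xor-cancelˡ a b = trans (cong (_xor a) (xor-comm a b)) (xor-cancelʳ b a)

≡ᵇ-refl : ∀ m → (m ≡ᵇ m) ≡ true
≡ᵇ-refl m = Equivalence.to T-≡ (≡⇒≡ᵇ m m refl)

≡ᵇ-false : ∀ {m n} → m ≢ n → (m ≡ᵇ n) ≡ false
≡ᵇ-false {m} {n} m≢n = T-ext (⊥-elim ∘ m≢n ∘ ≡ᵇ⇒≡ m n) ⊥-elim

≤ᵇ-false : ∀ {m n} → n < m → (m ≤ᵇ n) ≡ false
≤ᵇ-false {m} {n} n<m = T-ext (⊥-elim ∘ <⇒≱ n<m ∘ ≤ᵇ⇒≤ m n) ⊥-elim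

≤ᵇ-xor-suc : ∀ a c → ((a ≤ᵇ c) xor (suc a ≤ᵇ c)) ≡ (a ≡ᵇ c)
≤ᵇ-xor-suc zero    zero    = refl
≤ᵇ-xor-suc zero    (suc c) = refl
≤ᵇ-xor-suc (suc a) zero    = refl
≤ᵇ-xor-suc (suc a) (suc c) = trans (cong (_xor (a <ᵇ c)) (<ᵇ-suc a)) (≤ᵇ-xor-suc a c)
  where
  <ᵇ-suc : ∀ a → (a <ᵇ suc c) ≡ (a ≤ᵇ c)
  <ᵇ-suc zero    = refl
  <ᵇ-suc (suc a) = refl

module _ (G : Graph) where

  adj-< : ∀ {i j} → toℕ i < toℕ j → adj G i j ≡ e G i j
  adj-< i<j rewrite <ᵇ-true i<j = refl

  adj-> : ∀ {i j} → toℕ j < toℕ i → adj G i j ≡ e G j i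
  adj-> j<i rewrite <ᵇ-false (<-asym j<i) | <ᵇ-true j<i = refl

  adj-irrefl : ∀ i → adj G i i ≡ false
  adj-irrefl i rewrite <ᵇ-false (<-irrefl {toℕ i} refl) = refl

  adj⇒toℕ≢ : ∀ {i j} → T (adj G i j) → toℕ i ≢ toℕ j
  adj⇒toℕ≢ {i} {j} ij i≡j = subst T (adj-irrefl j) (subst (λ z → T (adj G z j)) (toℕ-injective i≡j) ij)

  adj-sym : ∀ i j → adj G i j ≡ adj G j i
  adj-sym i j with <-cmp (toℕ i) (toℕ j)
  ... | tri< i<j _ _ = trans (adj-< i<j) (sym (adj-> i<j))
  ... | tri≈ _ i≡j _ rewrite toℕ-injective i≡j = refl
  ... | tri> _ _ j<i = trans (adj-> j<i) (sym (adj-< j<i))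

adj≡e : ∀ G → (∀ i j → e G i j ≡ e G j i) → (∀ i → e G i i ≡ false) → ∀ i j → adj G i j ≡ e G i j
adj≡e G e-sym e-irrefl i j with <-cmp (toℕ i) (toℕ j)
... | tri< i<j _ _ = adj-< G i<j
... | tri> _ _ j<i = trans (adj-> G j<i) (e-sym j i)
... | tri≈ _ i≡j _ rewrite toℕ-injective i≡j = trans (adj-irrefl G j) (sym (e-irrefl j))

anyᶠ⁺ : ∀ {m} (f : Fin m → Bool) i → T (f i) → T (anyᶠ f)
anyᶠ⁺ f fzero    p = Equivalence.from T-∨ (inj₁ p)
anyᶠ⁺ f (fsuc i) p = Equivalence.from T-∨ (inj₂ (anyᶠ⁺ (f ∘ fsuc) i p))

anyᶠ⁻ : ∀ {m} (f : Fin m → Bool) → T (anyᶠ f) → ∃ λ i → T (f i)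
anyᶠ⁻ {suc m} f p with Equivalence.to T-∨ p
... | inj₁ q = fzero , q
... | inj₂ q with anyᶠ⁻ (f ∘ fsuc) q
...   | i , r = fsuc i , r

anyᶠ-cong : ∀ {m} {f g : Fin m → Bool} → (∀ i → f i ≡ g i) → anyᶠ f ≡ anyᶠ g
anyᶠ-cong {zero}  f≗g = refl
anyᶠ-cong {suc m} f≗g = cong₂ _∨_ (f≗g fzero) (anyᶠ-cong (f≗g ∘ fsuc))

anyᶠ-reindex : ∀ {m k} (f : Fin m → Bool) (π : Fin k → Fin m) (ρ : Fin m → Fin k) →
  (∀ i → π (ρ i) ≡ i) → anyᶠ (f ∘ π) ≡ anyᶠ f
anyᶠ-reindex f π ρ π∘ρ = T-ext
  (λ p → let (j , q) = anyᶠ⁻ (f ∘ π) p in anyᶠ⁺ f (π j) q)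
  (λ p → let (i , q) = anyᶠ⁻ f p in anyᶠ⁺ (f ∘ π) (ρ i) (subst (T ∘ f) (sym (π∘ρ i)) q))

adj⇒hasNbr : ∀ G {i} j → T (adj G i j) → T (hasNbr G i)
adj⇒hasNbr G {i} = anyᶠ⁺ (adj G i)

NV-≡ : ∀ {G} {u v : NV G} → proj₁ u ≡ proj₁ v → u ≡ v
NV-≡ {u = i , p} {v = .i , q} refl = cong (i ,_) (T-irrelevant p q)

≅-injective : ∀ {X G} (iso : X ≅ G) {a b : NV X} →
  proj₁ (Inverse.to (proj₁ iso) a) ≡ proj₁ (Inverse.to (proj₁ iso) b) → a ≡ b
≅-injective (φ , _) = Injection.injective (↔⇒↣ φ) ∘ NV-≡

≅-sym : ∀ {X Y} → X ≅ Y → Y ≅ X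
≅-sym {X} {Y} (φ , φ-adj) =
  mk↔ₛ′ from to strictlyInverseʳ strictlyInverseˡ ,
  λ a b → trans (sym (φ-adj (from a) (from b)))
            (cong₂ (λ x y → adj Y (proj₁ x) (proj₁ y)) (strictlyInverseˡ a) (strictlyInverseˡ b))
  where open Inverse φ

≅-trans : ∀ {X Y Z} → X ≅ Y → Y ≅ Z → X ≅ Z
≅-trans (φ , φ-adj) (χ , χ-adj) =
  mk↔ₛ′ (χ.to ∘ φ.to) (φ.from ∘ χ.from)
    (λ z → trans (cong χ.to (φ.strictlyInverseˡ _)) (χ.strictlyInverseˡ z))
    (λ x → trans (cong φ.from (χ.strictlyInverseʳ _)) (φ.strictlyInverseʳ x)) ,
  λ u v → trans (χ-adj (φ.to u) (φ.to v)) (φ-adj u v)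
  where
  module φ = Inverse φ
  module χ = Inverse χ

bijection⇒≅ : ∀ {X Y} (to : Fin (n X) → Fin (n Y)) (from : Fin (n Y) → Fin (n X)) →
  (∀ y → to (from y) ≡ y) → (∀ x → from (to x) ≡ x) →
  (∀ u v → adj Y (to u) (to v) ≡ adj X u v) → X ≅ Y
bijection⇒≅ {X} {Y} to from to∘from from∘to to-adj =
  mk↔ₛ′ toNV fromNV (λ _ → NV-≡ (to∘from _)) (λ _ → NV-≡ (from∘to _)) ,
  λ u v → to-adj (proj₁ u) (proj₁ v)
  where
  hasNbr-to : ∀ u → hasNbr Y (to u) ≡ hasNbr X u
  hasNbr-to u = trans (sym (anyᶠ-reindex (adj Y (to u)) to from to∘from)) (anyᶠ-cong (to-adj u))
  toNV : NV X → NV Y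
  toNV (u , p) = to u , subst T (sym (hasNbr-to u)) p
  fromNV : NV Y → NV X
  fromNV (y , p) = from y , subst T (hasNbr-to (from y)) (subst (T ∘ hasNbr Y) (sym (to∘from y)) p)

Reach-trans : ∀ {G u v w} → Reach G u v → Reach G v w → Reach G u w
Reach-trans here         r = r
Reach-trans (step uv r) r′ = step uv (Reach-trans r r′)

Reach-sym : ∀ {G u v} → Reach G u v → Reach G v u
Reach-sym here = here
Reach-sym {G} (step {u} {v} uv r) = Reach-trans (Reach-sym r) (step (subst T (adj-sym G u v) uv) here)

Reach-invariant : ∀ {G} (label : Fin (n G) → Bool) →
  (∀ u v → T (adj G u v) → label u ≡ label v) → ∀ {u v} → Reach G u v → label u ≡ label v
Reach-invariant label edge-inv here         = refl
Reach-invariant label edge-inv (step uv r) = trans (edge-inv _ _ uv) (Reach-invariant label edge-inv r)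

AllReachable : Graph → Set
AllReachable G = ∀ (u v : NV G) → Reach G (proj₁ u) (proj₁ v)

AllReachable-≅ : ∀ {X Y} → X ≅ Y → AllReachable Y → AllReachable X
AllReachable-≅ {X} {Y} iso@(φ , φ-adj) reachY a b = pull (reachY (to a) (to b)) a refl
  where
  open Inverse φ
  pull : ∀ {x} → Reach Y x (proj₁ (to b)) → (a : NV X) → proj₁ (to a) ≡ x → Reach X (proj₁ a) (proj₁ b)
  pull here a a↦b = subst (λ z → Reach X (proj₁ a) (proj₁ z)) (≅-injective iso a↦b) here
  pull {x} (step {v = v} xv r) a refl = step a~a′ (pull r a′ (cong proj₁ (strictlyInverseˡ (v , v∈NV))))
    where
    v∈NV : T (hasNbr Y v)
    v∈NV = adj⇒hasNbr Y x (subst T (adj-sym Y x v) xv)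
    a′ = from (v , v∈NV)
    a~a′ : T (adj X (proj₁ a) (proj₁ a′))
    a~a′ = subst T (trans (cong (adj Y x ∘ proj₁) (sym (strictlyInverseˡ (v , v∈NV)))) (φ-adj a a′)) xv

∃-function? : ∀ a {b} (P : (Fin a → Fin b) → Set) → (∀ f → Dec (P f)) →
  (∀ {f g} → (∀ i → f i ≡ g i) → P f → P g) → Dec (∃ P)
∃-function? zero P P? P-cong with P? (λ ())
... | yes p = yes (_ , p)
... | no ¬p = no λ (f , pf) → ¬p (P-cong (λ ()) pf)
∃-function? (suc a) P P? P-cong
  with any? (λ x → ∃-function? a (P ∘ (x ∷ᶠ_)) (P? ∘ (x ∷ᶠ_)) (P-cong ∘ ∷-cong x))
  where
  ∷-cong : ∀ x {f g} → (∀ i → f i ≡ g i) → ∀ i → (x ∷ᶠ f) i ≡ (x ∷ᶠ g) i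
  ∷-cong x f≗g fzero    = refl
  ∷-cong x f≗g (fsuc i) = f≗g i
... | yes (x , f , pf) = yes (x ∷ᶠ f , pf)
... | no ¬p = no λ (f , pf) → ¬p (f fzero , f ∘ fsuc , P-cong η pf)
  where
  η : ∀ {f : Fin (suc a) → _} i → f i ≡ (f fzero ∷ᶠ f ∘ fsuc) i
  η fzero    = refl
  η (fsuc i) = refl

module _ (X G : Graph) where

  record IsIsoMap (f : Fin (n X) → Fin (n G)) : Set where
    field
      nonIsolated  : ∀ i → T (hasNbr X i) → T (hasNbr G (f i))
      injectiveOn  : ∀ i j → T (hasNbr X i) → T (hasNbr X j) → f i ≡ f j → i ≡ j
      surjectiveOn : ∀ y → T (hasNbr G y) → ∃ λ i → T (hasNbr X i) × f i ≡ y
      preservesAdj : ∀ i j → T (hasNbr X i) → T (hasNbr X j) → adj G (f i) (f j) ≡ adj X i j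

  isIsoMap? : ∀ f → Dec (IsIsoMap f)
  isIsoMap? f
    with all? (λ i → T? (hasNbr X i) →-dec T? (hasNbr G (f i)))
       | all? (λ i → all? (λ j → T? (hasNbr X i) →-dec T? (hasNbr X j) →-dec (f i ≟ f j) →-dec (i ≟ j)))
       | all? (λ y → T? (hasNbr G y) →-dec any? (λ i → T? (hasNbr X i) ×-dec (f i ≟ y)))
       | all? (λ i → all? (λ j → T? (hasNbr X i) →-dec T? (hasNbr X j) →-dec (adj G (f i) (f j) ≟ᵇ adj X i j)))
  ... | yes a | yes b | yes c | yes d = yes record
    { nonIsolated = a ; injectiveOn = b ; surjectiveOn = c ; preservesAdj = d }
  ... | no ¬a | _     | _     | _     = no (¬a ∘ IsIsoMap.nonIsolated)
  ... | yes _ | no ¬b | _     | _     = no (¬b ∘ IsIsoMap.injectiveOn)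
  ... | yes _ | yes _ | no ¬c | _     = no (¬c ∘ IsIsoMap.surjectiveOn)
  ... | yes _ | yes _ | yes _ | no ¬d = no (¬d ∘ IsIsoMap.preservesAdj)

  IsIsoMap-cong : ∀ {f g} → (∀ i → f i ≡ g i) → IsIsoMap f → IsIsoMap g
  IsIsoMap-cong {f} {g} f≗g isoF = record
    { nonIsolated  = λ i p → subst (T ∘ hasNbr G) (f≗g i) (nonIsolated i p)
    ; injectiveOn  = λ i j p q gi≡gj → injectiveOn i j p q (trans (f≗g i) (trans gi≡gj (sym (f≗g j))))
    ; surjectiveOn = λ y q → let (i , p , fi≡y) = surjectiveOn y q in i , p , trans (sym (f≗g i)) fi≡y
    ; preservesAdj = λ i j p q → trans (cong₂ (adj G) (sym (f≗g i)) (sym (f≗g j))) (preservesAdj i j p q)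
    }
    where open IsIsoMap isoF

  IsIsoMap⇒≅ : ∀ {f} → IsIsoMap f → X ≅ G
  IsIsoMap⇒≅ {f} isoF =
    mk↔ₛ′ to from
      (λ (y , q) → NV-≡ (proj₂ (proj₂ (surjectiveOn y q))))
      (λ (i , p) → let (j , q , fj≡fi) = surjectiveOn (f i) (nonIsolated i p) in NV-≡ (injectiveOn j i q p fj≡fi)) ,
    λ u v → preservesAdj (proj₁ u) (proj₁ v) (proj₂ u) (proj₂ v)
    where
    open IsIsoMap isoF
    to : NV X → NV G
    to (i , p) = f i , nonIsolated i p
    from : NV G → NV X
    from (y , q) = let (i , p , _) = surjectiveOn y q in i , p

  -- Isolated vertices of X, about which X ≅ G says nothing, are sent to the default vertex y₀.
  ≅⇒IsIsoMap : Fin (n G) → X ≅ G → ∃ IsIsoMap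
  ≅⇒IsIsoMap y₀ iso@(φ , φ-adj) = f , record
    { nonIsolated  = λ i p → subst (T ∘ hasNbr G) (sym (f-to i p)) (proj₂ (to (i , p)))
    ; injectiveOn  = λ i j p q fi≡fj → cong proj₁ (≅-injective iso (trans (sym (f-to i p)) (trans fi≡fj (f-to j q))))
    ; surjectiveOn = λ y q → proj₁ (from (y , q)) , proj₂ (from (y , q)) ,
        trans (f-to _ (proj₂ (from (y , q)))) (cong proj₁ (strictlyInverseˡ (y , q)))
    ; preservesAdj = λ i j p q → trans (cong₂ (adj G) (f-to i p) (f-to j q)) (φ-adj (i , p) (j , q))
    }
    where
    open Inverse φ
    fBy : ∀ i b → hasNbr X i ≡ b → Fin (n G)
    fBy i true  eq = proj₁ (to (i , Equivalence.from T-≡ eq))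
    fBy i false _  = y₀
    f : Fin (n X) → Fin (n G)
    f i = fBy i (hasNbr X i) refl
    fBy-to : ∀ i b (eq : hasNbr X i ≡ b) (p : T (hasNbr X i)) → fBy i b eq ≡ proj₁ (to (i , p))
    fBy-to i true  eq p = cong (λ q → proj₁ (to (i , q))) (T-irrelevant _ p)
    fBy-to i false eq p = ⊥-elim (subst T eq p)
    f-to : ∀ i (p : T (hasNbr X i)) → f i ≡ proj₁ (to (i , p))
    f-to i = fBy-to i (hasNbr X i) refl

  ≅? : Fin (n G) → Dec (X ≅ G)
  ≅? y₀ with ∃-function? (n X) IsIsoMap isIsoMap? IsIsoMap-cong
  ... | yes (_ , isoF) = yes (IsIsoMap⇒≅ isoF)
  ... | no ¬isoF       = no (¬isoF ∘ ≅⇒IsIsoMap y₀)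

Unique-concatMap⁺ : ∀ {A B : Set} {f : A → List B} {xs : List A} (key : B → A) →
  (∀ x {y} → y ∈ f x → key y ≡ x) → (∀ x → Unique (f x)) → Unique xs → Unique (concatMap f xs)
Unique-concatMap⁺ key f-key f-unique [] = []
Unique-concatMap⁺ {f = f} {xs = x ∷ xs} key f-key f-unique (x∉xs ∷ xs-unique) =
  ++⁺ (f-unique x) (Unique-concatMap⁺ key f-key f-unique xs-unique) λ (p , q) → disjoint p q
  where
  disjoint : ∀ {y} → y ∈ f x → y ∈ concatMap f xs → _
  disjoint p q = go x∉xs (∈-concatMap⁻ f {xs = xs} q)
    where
    go : ∀ {zs} → All (λ z → ¬ x ≡ z) zs → Any (λ z → _ ∈ f z) zs → _
    go (x≢z ∷ _)  (here r)  = x≢z (trans (sym (f-key x p)) (f-key _ r))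
    go (_ ∷ x∉zs) (there r) = go x∉zs r

∈-if⁺ : ∀ {B : Set} {b} {p : B} → T b → p ∈ (if b then [ p ] else [])
∈-if⁺ {b = true} _ = here refl

∈-if⁻ : ∀ {B : Set} b {p y : B} → y ∈ (if b then [ p ] else []) → T b × y ≡ p
∈-if⁻ true (here y≡p) = _ , y≡p

Unique-if : ∀ {B : Set} b (p : B) → Unique (if b then [ p ] else [])
Unique-if true  p = [] ∷ []
Unique-if false p = []

module _ (G : Graph) where

  isEdge : Fin (n G) → Fin (n G) → Bool
  isEdge i j = (toℕ i <ᵇ toℕ j) ∧ e G i j

  edgeList-unique : Unique (edgeList G)
  edgeList-unique = Unique-concatMap⁺ proj₁
    (λ i p → let (j , q) = Any.satisfied (∈-concatMap⁻ _ {xs = allFin (n G)} p) in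
       cong proj₁ (proj₂ (∈-if⁻ (isEdge i j) q)))
    (λ i → Unique-concatMap⁺ proj₂ (λ j p → cong proj₂ (proj₂ (∈-if⁻ (isEdge i j) p)))
             (λ j → Unique-if (isEdge i j) _) (allFin⁺ _))
    (allFin⁺ _)

  ∈-edgeList⁻ : ∀ {i j} → (i , j) ∈ edgeList G → toℕ i < toℕ j × T (e G i j)
  ∈-edgeList⁻ {i} {j} p with Any.satisfied (∈-concatMap⁻ _ {xs = allFin (n G)} p)
  ... | x , q with Any.satisfied (∈-concatMap⁻ _ {xs = allFin (n G)} q)
  ...   | y , r with ∈-if⁻ (isEdge x y) r
  ...     | edge , refl with Equivalence.to T-∧ edge
  ...       | x<y , exy = <ᵇ⇒< _ _ x<y , exy

  ∈-edgeList⁺ : ∀ {i j} → toℕ i < toℕ j → T (e G i j) → (i , j) ∈ edgeList G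
  ∈-edgeList⁺ {i} {j} i<j eij =
    ∈-concatMap⁺ _ {xs = allFin (n G)} (Any.map (λ { refl →
      ∈-concatMap⁺ _ {xs = allFin (n G)} (Any.map (λ { refl →
        ∈-if⁺ (Equivalence.from T-∧ (<⇒<ᵇ i<j , eij)) }) (∈-allFin j)) }) (∈-allFin i))

samePair : ∀ {k} → Fin k × Fin k → Fin k × Fin k → Bool
samePair (a , b) (i , j) = ⌊ a ≟ i ⌋ ∧ ⌊ b ≟ j ⌋

samePair⇒≡ : ∀ {k} {x p : Fin k × Fin k} → T (samePair x p) → x ≡ p
samePair⇒≡ {x = a , b} {i , j} same with a ≟ i | b ≟ j
... | yes refl | yes refl = refl

samePair-refl : ∀ {k} (p : Fin k × Fin k) → samePair p p ≡ true
samePair-refl (a , b) with a ≟ a | b ≟ b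
... | yes _   | yes _   = refl
... | no a≢a  | _       = ⊥-elim (a≢a refl)
... | yes _   | no b≢b  = ⊥-elim (b≢b refl)

selects : ∀ {k} (xs : List (Fin k × Fin k)) → Vec Bool (length xs) → Fin k × Fin k → Bool
selects []       []        p = false
selects (x ∷ xs) (bit ∷ F) p = (bit ∧ samePair x p) ∨ selects xs F p

tabulateOn : ∀ {A : Set} (xs : List A) → (A → Bool) → Vec Bool (length xs)
tabulateOn []       g = []
tabulateOn (x ∷ xs) g = g x ∷ tabulateOn xs g

tabulateOn-cong : ∀ {A : Set} (xs : List A) {g g′ : A → Bool} →
  (∀ y → y ∈ xs → g y ≡ g′ y) → tabulateOn xs g ≡ tabulateOn xs g′
tabulateOn-cong []       g≗g′ = refl
tabulateOn-cong (x ∷ xs) g≗g′ = cong₂ _∷_ (g≗g′ x (here refl)) (tabulateOn-cong xs (λ y → g≗g′ y ∘ there))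

selects⇒∈ : ∀ {k} (xs : List (Fin k × Fin k)) F p → T (selects xs F p) → p ∈ xs
selects⇒∈ []       []        p ()
selects⇒∈ (x ∷ xs) (false ∷ F) p sel = there (selects⇒∈ xs F p sel)
selects⇒∈ (x ∷ xs) (true ∷ F)  p sel with samePair x p in same
... | true  = here (sym (samePair⇒≡ (Equivalence.from T-≡ same)))
... | false = there (selects⇒∈ xs F p sel)

selects-tabulateOn⁻ : ∀ {k} (xs : List (Fin k × Fin k)) g p → T (selects xs (tabulateOn xs g) p) → T (g p)
selects-tabulateOn⁻ []       g p ()
selects-tabulateOn⁻ (x ∷ xs) g p sel with g x in gx | samePair x p in same | sel
... | true  | true  | _    = subst (T ∘ g) (samePair⇒≡ (Equivalence.from T-≡ same)) (Equivalence.from T-≡ gx)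
... | true  | false | rest = selects-tabulateOn⁻ xs g p rest
... | false | _     | rest = selects-tabulateOn⁻ xs g p rest

selects-tabulateOn⁺ : ∀ {k} (xs : List (Fin k × Fin k)) g p → p ∈ xs → T (g p) → T (selects xs (tabulateOn xs g) p)
selects-tabulateOn⁺ (x ∷ xs) g p (here refl) gp rewrite Equivalence.to T-≡ gp | samePair-refl p = _
selects-tabulateOn⁺ (x ∷ xs) g p (there p∈xs) gp with g x ∧ samePair x p
... | true  = _
... | false = selects-tabulateOn⁺ xs g p p∈xs gp

tabulateOn-selects : ∀ {k} (xs : List (Fin k × Fin k)) F → Unique xs → F ≡ tabulateOn xs (selects xs F)
tabulateOn-selects []       []        []              = refl
tabulateOn-selects (x ∷ xs) (bit ∷ F) (x∉xs ∷ unique) =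
  cong₂ _∷_ head (trans (tabulateOn-selects xs F unique) (tabulateOn-cong xs tail))
  where
  selects-x : selects xs F x ≡ false
  selects-x = T-ext (⊥-elim ∘ All¬⇒¬Any x∉xs ∘ selects⇒∈ xs F x) ⊥-elim
  head : bit ≡ ((bit ∧ samePair x x) ∨ selects xs F x)
  head rewrite samePair-refl x | selects-x | ∧-identityʳ bit = sym (∨-identityʳ bit)
  samePair-x : ∀ {y} → y ∈ xs → samePair x y ≡ false
  samePair-x y∈xs = T-ext (λ same → ⊥-elim (All¬⇒¬Any x∉xs (subst (_∈ xs) (sym (samePair⇒≡ same)) y∈xs))) ⊥-elim
  tail : ∀ y → y ∈ xs → selects xs F y ≡ ((bit ∧ samePair x y) ∨ selects xs F y)
  tail y y∈xs rewrite samePair-x y∈xs | ∧-zeroʳ bit = refl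

any-zip-selects : ∀ {k} {Q : (Fin k × Fin k) × Bool → Bool} i j →
  (∀ a b bit → Q ((a , b) , bit) ≡ (bit ∧ samePair (a , b) (i , j))) →
  ∀ xs (F : Vec Bool (length xs)) → any Q (zip xs (toList F)) ≡ selects xs F (i , j)
any-zip-selects i j Q-spec []             []        = refl
any-zip-selects i j Q-spec ((a , b) ∷ xs) (bit ∷ F) = cong₂ _∨_ (Q-spec a b bit) (any-zip-selects i j Q-spec xs F)

module _ (H : Graph) where
  open ≡-Reasoning

  e-subgraph : ∀ F i j → e (subgraph H F) i j ≡ selects (edgeList H) F (i , j)
  e-subgraph F i j = any-zip-selects i j (λ _ _ _ → refl) (edgeList H) F

  adj-subgraph-< : ∀ F {i j} → toℕ i < toℕ j → adj (subgraph H F) i j ≡ selects (edgeList H) F (i , j)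
  adj-subgraph-< F {i} {j} i<j = trans (adj-< (subgraph H F) i<j) (e-subgraph F i j)

  adj-subgraph⇒adj : ∀ F i j → T (adj (subgraph H F) i j) → T (adj H i j)
  adj-subgraph⇒adj F i j ij with <-cmp (toℕ i) (toℕ j)
  ... | tri< i<j _ _ = subst T (sym (adj-< H i<j))
    (proj₂ (∈-edgeList⁻ H (selects⇒∈ _ F _ (subst T (adj-subgraph-< F i<j) ij))))
  ... | tri> _ _ j<i = subst T (sym (adj-> H j<i))
    (proj₂ (∈-edgeList⁻ H (selects⇒∈ _ F _ (subst T (trans (adj-sym (subgraph H F) i j) (adj-subgraph-< F j<i)) ij))))
  ... | tri≈ _ i≡j _ = ⊥-elim (adj⇒toℕ≢ (subgraph H F) ij i≡j)

  restrict : (Fin (n H) → Fin (n H) → Bool) → EdgeSubset H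
  restrict g = tabulateOn (edgeList H) (λ (i , j) → g i j)

  selects-restrict : ∀ g {i j} → toℕ i < toℕ j → selects (edgeList H) (restrict g) (i , j) ≡ (e H i j ∧ g i j)
  selects-restrict g {i} {j} i<j = T-ext
    (λ sel → Equivalence.from (T-∧ {e H i j})
      (proj₂ (∈-edgeList⁻ H (selects⇒∈ _ _ _ sel)) , selects-tabulateOn⁻ (edgeList H) _ _ sel))
    (λ eg → let (eij , gij) = Equivalence.to (T-∧ {e H i j}) eg in
      selects-tabulateOn⁺ (edgeList H) _ _ (∈-edgeList⁺ H i<j eij) gij)

  adj-restrict : ∀ g → (∀ i j → g i j ≡ g j i) → ∀ i j → adj (subgraph H (restrict g)) i j ≡ (adj H i j ∧ g i j)
  adj-restrict g g-sym i j with <-cmp (toℕ i) (toℕ j)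
  ... | tri< i<j _ _ = begin
    adj (subgraph H (restrict g)) i j ≡⟨ adj-subgraph-< (restrict g) i<j ⟩
    selects (edgeList H) (restrict g) (i , j) ≡⟨ selects-restrict g i<j ⟩
    e H i j ∧ g i j ≡⟨ cong (_∧ g i j) (adj-< H i<j) ⟨
    adj H i j ∧ g i j ∎
  ... | tri> _ _ j<i = begin
    adj (subgraph H (restrict g)) i j ≡⟨ adj-sym (subgraph H (restrict g)) i j ⟩
    adj (subgraph H (restrict g)) j i ≡⟨ adj-subgraph-< (restrict g) j<i ⟩
    selects (edgeList H) (restrict g) (j , i) ≡⟨ selects-restrict g j<i ⟩
    e H j i ∧ g j i ≡⟨ cong₂ _∧_ (adj-> H j<i) (g-sym i j) ⟨
    adj H i j ∧ g i j ∎
  ... | tri≈ _ i≡j _ rewrite toℕ-injective i≡j | adj-irrefl (subgraph H (restrict g)) j | adj-irrefl H j = refl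

  restrict-adj-subgraph : ∀ F → F ≡ restrict (adj (subgraph H F))
  restrict-adj-subgraph F = trans (tabulateOn-selects (edgeList H) F (edgeList-unique H))
    (tabulateOn-cong (edgeList H) λ (i , j) ij∈E → sym (adj-subgraph-< F (proj₁ (∈-edgeList⁻ H ij∈E))))

-- Counting copies through a switching

allVecs : ∀ N → List (Vec Bool N)
allVecs zero    = [ [] ]
allVecs (suc N) = cartesianProductWith _∷_ (true ∷ false ∷ []) (allVecs N)

allVecs-unique : ∀ N → Unique (allVecs N)
allVecs-unique zero    = [] ∷ []
allVecs-unique (suc N) =
  cartesianProductWith⁺ {xs = true ∷ false ∷ []} _∷_ ∷-injective (((λ ()) ∷ []) ∷ [] ∷ []) (allVecs-unique N)

∈-allVecs : ∀ {N} (v : Vec Bool N) → v ∈ allVecs N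
∈-allVecs []          = here refl
∈-allVecs (true ∷ v)  = ∈-cartesianProductWith⁺ _∷_ {xs = true ∷ false ∷ []} (here refl) (∈-allVecs v)
∈-allVecs (false ∷ v) = ∈-cartesianProductWith⁺ _∷_ {xs = true ∷ false ∷ []} (there (here refl)) (∈-allVecs v)

Unique-map⁺-leftInverseOn : ∀ {A B : Set} {f : A → B} (g : B → A) {xs : List A} →
  (∀ {x} → x ∈ xs → g (f x) ≡ x) → Unique xs → Unique (map f xs)
Unique-map⁺-leftInverseOn {f = f} g {xs} g∘f unique =
  map⁻ {f = g} (subst Unique (trans (sym (map-id-local (All.tabulate g∘f))) (map-∘ xs)) unique)

firstFalse : ∀ {m} → (Fin m → Bool) → Maybe (Fin m)
firstFalse {zero}  f = nothing
firstFalse {suc m} f = if f fzero then Maybe.map fsuc (firstFalse (f ∘ fsuc)) else just fzero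

firstFalse-cong : ∀ {m} {f g : Fin m → Bool} → (∀ i → f i ≡ g i) → firstFalse f ≡ firstFalse g
firstFalse-cong {zero}  f≗g = refl
firstFalse-cong {suc m} f≗g =
  cong₂ (λ b r → if b then Maybe.map fsuc r else just fzero) (f≗g fzero) (firstFalse-cong (f≗g ∘ fsuc))

firstFalse-sound : ∀ {m} (f : Fin m → Bool) {c} → firstFalse f ≡ just c → f c ≡ false
firstFalse-sound {suc m} f eq with f fzero in f0 | firstFalse (f ∘ fsuc) in rest | eq
... | false | _      | refl = f0
... | true  | just c | refl = firstFalse-sound (f ∘ fsuc) rest

firstFalse-complete : ∀ {m} (f : Fin m → Bool) c → f c ≡ false → firstFalse f ≢ nothing
firstFalse-complete {suc m} f c fc with f fzero in f0
... | false = λ ()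
firstFalse-complete {suc m} f fzero    fc | true = ⊥-elim (subst T (trans (sym f0) fc) _)
firstFalse-complete {suc m} f (fsuc c) fc | true with firstFalse (f ∘ fsuc) in rest
... | just _  = λ ()
... | nothing = ⊥-elim (firstFalse-complete (f ∘ fsuc) c fc rest)

sortPair : ∀ {k} → Fin k → Fin k → Fin k × Fin k
sortPair x y = if toℕ x <ᵇ toℕ y then (x , y) else (y , x)

sortPair-cases : ∀ {k} (x y : Fin k) → sortPair x y ≡ (x , y) ⊎ sortPair x y ≡ (y , x)
sortPair-cases x y with toℕ x <ᵇ toℕ y
... | true  = inj₁ refl
... | false = inj₂ refl

sortPair-injective : ∀ {k} {x y x′ y′ : Fin k} → sortPair x y ≡ sortPair x′ y′ →
  (x ≡ x′ × y ≡ y′) ⊎ (x ≡ y′ × y ≡ x′)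
sortPair-injective {x = x} {y} {x′} {y′} eq with sortPair-cases x y | sortPair-cases x′ y′
... | inj₁ a | inj₁ b = let q = trans (sym a) (trans eq b) in inj₁ (cong proj₁ q , cong proj₂ q)
... | inj₁ a | inj₂ b = let q = trans (sym a) (trans eq b) in inj₂ (cong proj₁ q , cong proj₂ q)
... | inj₂ a | inj₁ b = let q = trans (sym a) (trans eq b) in inj₂ (cong proj₂ q , cong proj₁ q)
... | inj₂ a | inj₂ b = let q = trans (sym a) (trans eq b) in inj₁ (cong proj₂ q , cong proj₁ q)

adj⇒sortPair∈edgeList : ∀ G {x y} → T (adj G x y) → sortPair x y ∈ edgeList G
adj⇒sortPair∈edgeList G {x} {y} xy with <-cmp (toℕ x) (toℕ y)
... | tri< x<y _ _ = subst (_∈ edgeList G) (cong (λ b → if b then (x , y) else (y , x)) (sym (<ᵇ-true x<y)))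
  (∈-edgeList⁺ G x<y (subst T (adj-< G x<y) xy))
... | tri> _ _ y<x = subst (_∈ edgeList G) (cong (λ b → if b then (x , y) else (y , x)) (sym (<ᵇ-false (<-asym y<x))))
  (∈-edgeList⁺ G y<x (subst T (adj-> G y<x) xy))
... | tri≈ _ x≡y _ = ⊥-elim (adj⇒toℕ≢ G xy x≡y)

-- Distinct classes give distinct edges of G, since the class of an edge does not depend on its orientation.
classesOnEdges≤numEdges : ∀ {X G m} (class : Fin (n X) → Fin (n X) → Fin m) →
  (∀ u v → class u v ≡ class v u) → X ≅ G →
  (∀ c → ∃ λ u → ∃ λ v → T (adj X u v) × class u v ≡ c) → m ≤ numEdges G
classesOnEdges≤numEdges {X} {G} class class-sym iso@(φ , φ-adj) onEdge = injective⇒≤ {f = index} index-injective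
  where
  open Inverse φ
  source target : _ → NV X
  source c = let (u , v , uv , _) = onEdge c in u , adj⇒hasNbr X v uv
  target c = let (u , v , uv , _) = onEdge c in v , adj⇒hasNbr X u (subst T (adj-sym X u v) uv)
  x y : _ → Fin (n G)
  x = proj₁ ∘ to ∘ source
  y = proj₁ ∘ to ∘ target
  class-source-target : ∀ c → class (proj₁ (source c)) (proj₁ (target c)) ≡ c
  class-source-target c = proj₂ (proj₂ (proj₂ (onEdge c)))
  xy∈E : ∀ c → sortPair (x c) (y c) ∈ edgeList G
  xy∈E c = adj⇒sortPair∈edgeList G (subst T (sym (φ-adj (source c) (target c))) (proj₁ (proj₂ (proj₂ (onEdge c)))))
  index : _ → Fin (numEdges G)
  index c = Any.index (xy∈E c)
  to-injective : ∀ {a b} → proj₁ (to a) ≡ proj₁ (to b) → proj₁ a ≡ proj₁ b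
  to-injective = cong proj₁ ∘ ≅-injective iso
  index-injective : ∀ {c c′} → index c ≡ index c′ → c ≡ c′
  index-injective {c} {c′} eq
    with sortPair-injective (trans (lookup-index (xy∈E c))
           (trans (cong (lookup (edgeList G)) eq) (sym (lookup-index (xy∈E c′)))))
  ... | inj₁ (xx , yy) = trans (sym (class-source-target c))
    (trans (cong₂ class (to-injective xx) (to-injective yy)) (class-source-target c′))
  ... | inj₂ (xy , yx) = trans (sym (class-source-target c))
    (trans (cong₂ class (to-injective xy) (to-injective yx)) (trans (class-sym _ _) (class-source-target c′)))

-- The edges of X and of Y are split into classes so that, for every class c, switch c is an
-- isomorphism between X and Y once the edges of class c are deleted from both.
record Switching (X Y : Graph) : Set where
  field
    classes         : ℕ
    classX          : Fin (n X) → Fin (n X) → Fin classes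
    classY          : Fin (n Y) → Fin (n Y) → Fin classes
    classX-sym      : ∀ u v → classX u v ≡ classX v u
    classY-sym      : ∀ u v → classY u v ≡ classY v u
    switch          : Fin classes → Fin (n X) → Fin (n Y)
    unswitch        : Fin classes → Fin (n Y) → Fin (n X)
    switch-unswitch : ∀ c y → switch c (unswitch c y) ≡ y
    unswitch-switch : ∀ c x → unswitch c (switch c x) ≡ x
    switch-adj      : ∀ c u v → T (adj X u v) → classX u v ≢ c → T (adj Y (switch c u) (switch c v))
    switch-class    : ∀ c u v → T (adj X u v) → classX u v ≢ c → classY (switch c u) (switch c v) ≡ classX u v
    unswitch-adj    : ∀ c u v → T (adj Y u v) → classY u v ≢ c → T (adj X (unswitch c u) (unswitch c v))
    unswitch-class  : ∀ c u v → T (adj Y u v) → classY u v ≢ c → classX (unswitch c u) (unswitch c v) ≡ classY u v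

Switching-sym : ∀ {X Y} → Switching X Y → Switching Y X
Switching-sym S = record
  { classes = classes ; classX = classY ; classY = classX ; classX-sym = classY-sym ; classY-sym = classX-sym
  ; switch = unswitch ; unswitch = switch ; switch-unswitch = unswitch-switch ; unswitch-switch = switch-unswitch
  ; switch-adj = unswitch-adj ; switch-class = unswitch-class ; unswitch-adj = switch-adj ; unswitch-class = switch-class
  }
  where open Switching S

module Transfer {X Y : Graph} (S : Switching X Y) where
  open Switching S

  meets : EdgeSubset X → Fin classes → Bool
  meets F c = anyᶠ λ u → anyᶠ λ v → adj (subgraph X F) u v ∧ ⌊ classX u v ≟ c ⌋

  Avoids : EdgeSubset X → Set
  Avoids F = ∃ λ c → meets F c ≡ false

  meets⁻ : ∀ F c → T (meets F c) → ∃ λ u → ∃ λ v → T (adj (subgraph X F) u v) × classX u v ≡ c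
  meets⁻ F c met with anyᶠ⁻ _ met
  ... | u , met-u with anyᶠ⁻ _ met-u
  ...   | v , uv with Equivalence.to (T-∧ {adj (subgraph X F) u v}) uv
  ...     | adj-uv , class-uv = u , v , adj-uv , toWitness class-uv

  avoids⇒class≢ : ∀ F c → meets F c ≡ false → ∀ u v → T (adj (subgraph X F) u v) → classX u v ≢ c
  avoids⇒class≢ F c avoid u v uv class≡c = subst T avoid
    (anyᶠ⁺ _ u (anyᶠ⁺ _ v (Equivalence.from (T-∧ {adj (subgraph X F) u v}) (uv , fromWitness class≡c))))

  ≅⇒Avoids : ∀ {G} F → subgraph X F ≅ G → numEdges G < classes → Avoids F
  ≅⇒Avoids {G} F iso few with any? (λ c → meets F c ≟ᵇ false)
  ... | yes avoid = avoid
  ... | no ¬avoid = ⊥-elim (<-irrefl refl (≤-trans few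
        (classesOnEdges≤numEdges classX classX-sym iso λ c → meets⁻ F c (met c))))
    where
    met : ∀ c → T (meets F c)
    met c with meets F c in met?
    ... | true  = _
    ... | false = ¬avoid (c , met?)

  transfer : Fin classes → EdgeSubset X → EdgeSubset Y
  transfer c F = restrict Y (λ a b → adj (subgraph X F) (unswitch c a) (unswitch c b))

  module _ (F : EdgeSubset X) (c : Fin classes) (avoid : meets F c ≡ false) where

    private
      inX : ∀ u v → T (adj (subgraph X F) u v) → T (adj X u v)
      inX = adj-subgraph⇒adj X F
      off-c : ∀ u v → T (adj (subgraph X F) u v) → classX u v ≢ c
      off-c = avoids⇒class≢ F c avoid

    adj-transfer : ∀ u v → adj (subgraph Y (transfer c F)) (switch c u) (switch c v) ≡ adj (subgraph X F) u v
    adj-transfer u v = begin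
      adj (subgraph Y (transfer c F)) (switch c u) (switch c v)
        ≡⟨ adj-restrict Y _ (λ a b → adj-sym (subgraph X F) (unswitch c a) (unswitch c b)) (switch c u) (switch c v) ⟩
      adj Y (switch c u) (switch c v) ∧ adj (subgraph X F) (unswitch c (switch c u)) (unswitch c (switch c v))
        ≡⟨ cong₂ (λ a b → adj Y (switch c u) (switch c v) ∧ adj (subgraph X F) a b)
                 (unswitch-switch c u) (unswitch-switch c v) ⟩
      adj Y (switch c u) (switch c v) ∧ adj (subgraph X F) u v
        ≡⟨ ∧-absorbˡ _ _ (λ uv → switch-adj c u v (inX u v uv) (off-c u v uv)) ⟩
      adj (subgraph X F) u v ∎
      where open ≡-Reasoning

    transfer-≅ : subgraph X F ≅ subgraph Y (transfer c F)
    transfer-≅ = bijection⇒≅ (switch c) (unswitch c) (switch-unswitch c) (unswitch-switch c) adj-transfer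

    meets-transfer : ∀ c′ →
      (anyᶠ λ a → anyᶠ λ b → adj (subgraph Y (transfer c F)) a b ∧ ⌊ classY a b ≟ c′ ⌋) ≡ meets F c′
    meets-transfer c′ = trans (sym (anyᶠ-reindex _ (switch c) (unswitch c) (switch-unswitch c)))
      (anyᶠ-cong λ u → trans (sym (anyᶠ-reindex _ (switch c) (unswitch c) (switch-unswitch c)))
        (anyᶠ-cong λ v → trans (cong (_∧ _) (adj-transfer u v))
          (∧-congˡ-guarded (adj (subgraph X F) u v) λ uv →
            cong (λ k → ⌊ k ≟ c′ ⌋) (switch-class c u v (inX u v uv) (off-c u v uv)))))

    transfer-back : restrict X (λ a b → adj (subgraph Y (transfer c F)) (switch c a) (switch c b)) ≡ F
    transfer-back = trans (tabulateOn-cong (edgeList X) (λ (u , v) _ → adj-transfer u v)) (sym (restrict-adj-subgraph X F))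

  -- Transfer along the first avoided class; the junk value for edge sets meeting every class is never used.
  transferFirst : EdgeSubset X → EdgeSubset Y
  transferFirst F = maybe′ (λ c → transfer c F) (replicate _ false) (firstFalse (meets F))

  firstAvoided : ∀ F → Avoids F → ∃ λ c → firstFalse (meets F) ≡ just c
  firstAvoided F (c , avoid) with firstFalse (meets F) in first≡
  ... | just c′ = c′ , refl
  ... | nothing = ⊥-elim (firstFalse-complete (meets F) c avoid first≡)

  transferFirst-≅ : ∀ F → Avoids F → subgraph X F ≅ subgraph Y (transferFirst F)
  transferFirst-≅ F avoids with firstAvoided F avoids
  ... | c , first≡c rewrite first≡c = transfer-≅ F c (firstFalse-sound (meets F) first≡c)

-- Transfer preserves which classes are met, so the way back uses the same class.
transferFirst-back : ∀ {X Y} (S : Switching X Y) F → Transfer.Avoids S F →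
  Transfer.transferFirst (Switching-sym S) (Transfer.transferFirst S F) ≡ F
transferFirst-back S F avoids with Transfer.firstAvoided S F avoids
... | c , first≡c rewrite first≡c = begin
  Back.transferFirst (transfer c F)
    ≡⟨ cong (maybe′ (λ c′ → Back.transfer c′ (transfer c F)) (replicate _ false))
         (trans (firstFalse-cong (meets-transfer F c avoid)) first≡c) ⟩
  Back.transfer c (transfer c F)
    ≡⟨ transfer-back F c avoid ⟩
  F ∎
  where
  open Transfer S
  open ≡-Reasoning
  module Back = Transfer (Switching-sym S)
  avoid = firstFalse-sound (meets F) first≡c

switching⇒sameCount : ∀ {X Y} (S : Switching X Y) G → Fin (n G) → numEdges G < Switching.classes S →
  ∃ λ k → ICount G X k × ICount G Y k
switching⇒sameCount {X} {Y} S G y₀ few =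
  length copies ,
  (copies , copiesˣ-unique , refl , ∈-copies) ,
  (map transferFirst copies , copiesʸ-unique , length-map transferFirst copies , ∈-copiesʸ)
  where
  open Transfer S
  module Back = Transfer (Switching-sym S)
  isCopy? = λ F → ≅? (subgraph X F) G y₀
  copies : List (EdgeSubset X)
  copies = filter isCopy? (allVecs (numEdges X))
  copiesˣ-unique : Unique copies
  copiesˣ-unique = filter⁺ isCopy? (allVecs-unique _)
  ∈-copies : ∀ F → (F ∈ copies) ⇔ (subgraph X F ≅ G)
  ∈-copies F = mk⇔ (proj₂ ∘ ∈-filter⁻ isCopy? {xs = allVecs _}) (∈-filter⁺ isCopy? {xs = allVecs _} (∈-allVecs F))
  avoids : ∀ {F} → F ∈ copies → Avoids F
  avoids {F} F∈ = ≅⇒Avoids F (Equivalence.to (∈-copies F) F∈) few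
  copiesʸ-unique : Unique (map transferFirst copies)
  copiesʸ-unique = Unique-map⁺-leftInverseOn Back.transferFirst
    (λ F∈ → transferFirst-back S _ (avoids F∈)) copiesˣ-unique
  ∈-copiesʸ : ∀ F′ → (F′ ∈ map transferFirst copies) ⇔ (subgraph Y F′ ≅ G)
  ∈-copiesʸ F′ = mk⇔ to from
    where
    to : F′ ∈ map transferFirst copies → subgraph Y F′ ≅ G
    to F′∈ with ∈-map⁻ transferFirst F′∈
    ... | F , F∈ , refl = ≅-trans (≅-sym (transferFirst-≅ F (avoids F∈))) (Equivalence.to (∈-copies F) F∈)
    from : subgraph Y F′ ≅ G → F′ ∈ map transferFirst copies
    from iso = subst (_∈ map transferFirst copies) (transferFirst-back (Switching-sym S) F′ avoids′)
      (∈-map⁺ transferFirst (Equivalence.from (∈-copies _)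
        (≅-trans (≅-sym (Back.transferFirst-≅ F′ avoids′)) iso)))
      where
      avoids′ = Back.≅⇒Avoids F′ iso few

-- Two-lifts and cycles

module TwoLift {m : ℕ} (base : Fin m → Fin m → Bool)
  (base-sym : ∀ x y → base x y ≡ base y x) (base-irrefl : ∀ x → base x x ≡ false) where

  Vertex : Set
  Vertex = Fin m ⊎ Fin m

  sheet : Vertex → Bool
  sheet (inj₁ _) = false
  sheet (inj₂ _) = true

  pos : Vertex → Fin m
  pos = reduce

  split : Fin (m + m) → Vertex
  split = splitAt m

  unsplit : Vertex → Fin (m + m)
  unsplit = join m m

  split-unsplit : ∀ u → split (unsplit u) ≡ u
  split-unsplit = splitAt-join m m

  -- The 2-lift with signature σ: vertices are pairs (sheet, position), and a base edge {x, y}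
  -- joins the two sheets iff σ x y.
  liftAdj : (Fin m → Fin m → Bool) → Vertex → Vertex → Bool
  liftAdj σ u v = base (pos u) (pos v) ∧ not ((sheet u xor sheet v) xor σ (pos u) (pos v))

  lift : (Fin m → Fin m → Bool) → Graph
  lift σ = graph (m + m) λ i j → liftAdj σ (split i) (split j)

  module _ (σ : Fin m → Fin m → Bool) (σ-sym : ∀ x y → σ x y ≡ σ y x) where

    adj-lift : ∀ i j → adj (lift σ) i j ≡ liftAdj σ (split i) (split j)
    adj-lift = adj≡e (lift σ)
      (λ i j → cong₂ (λ b s → b ∧ not s) (base-sym _ _)
                 (cong₂ _xor_ (xor-comm (sheet (split i)) (sheet (split j))) (σ-sym _ _)))
      (λ i → cong (λ b → b ∧ not ((sheet (split i) xor sheet (split i)) xor σ (pos (split i)) (pos (split i))))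
               (base-irrefl (pos (split i))))

    adj-lift-unsplit : ∀ u v → adj (lift σ) (unsplit u) (unsplit v) ≡ liftAdj σ u v
    adj-lift-unsplit u v = trans (adj-lift _ _) (cong₂ (liftAdj σ) (split-unsplit u) (split-unsplit v))

  liftAdj-cong : ∀ {σ σ′} u v → (T (base (pos u) (pos v)) → σ (pos u) (pos v) ≡ σ′ (pos u) (pos v)) →
    liftAdj σ u v ≡ liftAdj σ′ u v
  liftAdj-cong u v σ≡σ′ =
    ∧-congˡ-guarded (base (pos u) (pos v)) (cong (λ s → not ((sheet u xor sheet v) xor s)) ∘ σ≡σ′)

  inSheet : Bool → Fin m → Vertex
  inSheet false = inj₁
  inSheet true  = inj₂

  liftAdj-inSheet : ∀ σ s x y → liftAdj σ (inSheet s x) (inSheet s y) ≡ (base x y ∧ not (σ x y))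
  liftAdj-inSheet σ false x y = refl
  liftAdj-inSheet σ true  x y = refl

  sheet-untwisted : ∀ u v → T (liftAdj (λ _ _ → false) u v) → sheet u ≡ sheet v
  sheet-untwisted (inj₁ x) (inj₁ y) _  = refl
  sheet-untwisted (inj₂ x) (inj₂ y) _  = refl
  sheet-untwisted (inj₁ x) (inj₂ y) uv = ⊥-elim (proj₂ (Equivalence.to (T-∧ {base x y}) uv))
  sheet-untwisted (inj₂ x) (inj₁ y) uv = ⊥-elim (proj₂ (Equivalence.to (T-∧ {base x y}) uv))

  flipOn : (Fin m → Bool) → Vertex → Vertex
  flipOn S u = if S (pos u) then swap u else u

  pos-flipOn : ∀ S u → pos (flipOn S u) ≡ pos u
  pos-flipOn S (inj₁ x) with S x
  ... | true  = refl
  ... | false = refl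
  pos-flipOn S (inj₂ x) with S x
  ... | true  = refl
  ... | false = refl

  sheet-flipOn : ∀ S u → sheet (flipOn S u) ≡ (sheet u xor S (pos u))
  sheet-flipOn S (inj₁ x) with S x
  ... | true  = refl
  ... | false = refl
  sheet-flipOn S (inj₂ x) with S x
  ... | true  = refl
  ... | false = refl

  flipOn-involutive : ∀ S u → flipOn S (flipOn S u) ≡ u
  flipOn-involutive S (inj₁ x) with S x in Sx
  ... | true  rewrite Sx = refl
  ... | false rewrite Sx = refl
  flipOn-involutive S (inj₂ x) with S x in Sx
  ... | true  rewrite Sx = refl
  ... | false rewrite Sx = refl

  -- Flipping the sheets over a vertex set S adds the coboundary of S to the signature.
  liftAdj-flipOn : ∀ σ S u v →
    liftAdj σ (flipOn S u) (flipOn S v) ≡ liftAdj (λ x y → (S x xor S y) xor σ x y) u v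
  liftAdj-flipOn σ S u v
    rewrite pos-flipOn S u | pos-flipOn S v | sheet-flipOn S u | sheet-flipOn S v
          | xor-interchange (sheet u) (S (pos u)) (sheet v) (S (pos v))
          | xor-assoc (sheet u xor sheet v) (S (pos u) xor S (pos v)) (σ (pos u) (pos v)) = refl

  switchOn : (Fin m → Bool) → Fin (m + m) → Fin (m + m)
  switchOn S = unsplit ∘ flipOn S ∘ split

  split-switchOn : ∀ S i → split (switchOn S i) ≡ flipOn S (split i)
  split-switchOn S i = split-unsplit _

  switchOn-involutive : ∀ S i → switchOn S (switchOn S i) ≡ i
  switchOn-involutive S i rewrite split-switchOn S i | flipOn-involutive S (split i) = join-splitAt m m i

  lift-switching : ∀ {k} {σ σ′ : Fin m → Fin m → Bool} →
    (∀ x y → σ x y ≡ σ y x) → (∀ x y → σ′ x y ≡ σ′ y x) →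
    (class : Fin m → Fin m → Fin k) → (∀ x y → class x y ≡ class y x) → (cut : Fin k → Fin m → Bool) →
    (∀ c x y → T (base x y) → class x y ≢ c → (cut c x xor cut c y) ≡ (σ x y xor σ′ x y)) →
    Switching (lift σ) (lift σ′)
  lift-switching {k} {σ} {σ′} σ-sym σ′-sym class class-sym cut cut-coboundary = record
    { classes = k ; classX = liftClass ; classY = liftClass ; classX-sym = liftClass-sym ; classY-sym = liftClass-sym
    ; switch = switchOn ∘ cut ; unswitch = switchOn ∘ cut
    ; switch-unswitch = switchOn-involutive ∘ cut ; unswitch-switch = switchOn-involutive ∘ cut
    ; switch-adj   = λ c u v uv c≢ →
        subst T (sym (switch-agrees σ-sym σ′-sym (λ x y → xor-cancelʳ (σ x y) (σ′ x y)) c u v c≢)) uv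
    ; switch-class = λ c u v _ _ → liftClass-switch c u v
    ; unswitch-adj = λ c u v uv c≢ →
        subst T (sym (switch-agrees σ′-sym σ-sym (λ x y → xor-cancelˡ (σ x y) (σ′ x y)) c u v c≢)) uv
    ; unswitch-class = λ c u v _ _ → liftClass-switch c u v
    }
    where
    liftClass : Fin (m + m) → Fin (m + m) → Fin k
    liftClass i j = class (pos (split i)) (pos (split j))
    liftClass-sym : ∀ i j → liftClass i j ≡ liftClass j i
    liftClass-sym i j = class-sym _ _
    liftClass-switch : ∀ c i j → liftClass (switchOn (cut c) i) (switchOn (cut c) j) ≡ liftClass i j
    liftClass-switch c i j rewrite split-switchOn (cut c) i | split-switchOn (cut c) j
      | pos-flipOn (cut c) (split i) | pos-flipOn (cut c) (split j) = refl
    switch-agrees : ∀ {σ₁ σ₂} → (∀ x y → σ₁ x y ≡ σ₁ y x) → (∀ x y → σ₂ x y ≡ σ₂ y x) →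
      (∀ x y → ((σ x y xor σ′ x y) xor σ₂ x y) ≡ σ₁ x y) →
      ∀ c i j → liftClass i j ≢ c → adj (lift σ₂) (switchOn (cut c) i) (switchOn (cut c) j) ≡ adj (lift σ₁) i j
    switch-agrees {σ₁} {σ₂} σ₁-sym σ₂-sym sum c i j c≢ = begin
      adj (lift σ₂) (switchOn (cut c) i) (switchOn (cut c) j)
        ≡⟨ adj-lift σ₂ σ₂-sym _ _ ⟩
      liftAdj σ₂ (split (switchOn (cut c) i)) (split (switchOn (cut c) j))
        ≡⟨ cong₂ (liftAdj σ₂) (split-switchOn (cut c) i) (split-switchOn (cut c) j) ⟩
      liftAdj σ₂ (flipOn (cut c) (split i)) (flipOn (cut c) (split j))
        ≡⟨ liftAdj-flipOn σ₂ (cut c) (split i) (split j) ⟩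
      liftAdj (λ x y → (cut c x xor cut c y) xor σ₂ x y) (split i) (split j)
        ≡⟨ liftAdj-cong {σ = λ x y → (cut c x xor cut c y) xor σ₂ x y} {σ′ = σ₁} (split i) (split j) (λ xy →
             trans (cong (_xor σ₂ _ _) (cut-coboundary c _ _ xy c≢)) (sum _ _)) ⟩
      liftAdj σ₁ (split i) (split j)
        ≡⟨ adj-lift σ₁ σ₁-sym i j ⟨
      adj (lift σ₁) i j ∎
      where open ≡-Reasoning

-- The cycle C_{d+1} for d = L = k + 2, on the vertices 0, …, L.
module Cycle (k : ℕ) where

  L : ℕ
  L = suc (suc k)

  isSucc : Fin (suc L) → Fin (suc L) → Bool
  isSucc x y = suc (toℕ x) ≡ᵇ toℕ y

  isWrap₀ : Fin (suc L) → Fin (suc L) → Bool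
  isWrap₀ x y = (toℕ x ≡ᵇ 0) ∧ (toℕ y ≡ᵇ L)

  isWrap : Fin (suc L) → Fin (suc L) → Bool
  isWrap x y = isWrap₀ x y ∨ isWrap₀ y x

  cycle : Fin (suc L) → Fin (suc L) → Bool
  cycle x y = isSucc x y ∨ isSucc y x ∨ isWrap x y

  edgeClass : Fin (suc L) → Fin (suc L) → Fin (suc L)
  edgeClass x y = if isSucc x y then x else if isSucc y x then y else fromℕ L

  cut : Fin (suc L) → Fin (suc L) → Bool
  cut c x = toℕ x ≤ᵇ toℕ c

  isWrap-sym : ∀ x y → isWrap x y ≡ isWrap y x
  isWrap-sym x y = ∨-comm (isWrap₀ x y) (isWrap₀ y x)

  cycle-sym : ∀ x y → cycle x y ≡ cycle y x
  cycle-sym x y rewrite isWrap-sym x y with isSucc x y | isSucc y x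
  ... | true  | true  = refl
  ... | true  | false = refl
  ... | false | true  = refl
  ... | false | false = refl

  cycle-irrefl : ∀ x → cycle x x ≡ false
  cycle-irrefl x rewrite ≡ᵇ-false (1+n≢n {toℕ x}) = wrap-irrefl (toℕ x)
    where
    wrap-irrefl : ∀ a → (((a ≡ᵇ 0) ∧ (a ≡ᵇ L)) ∨ ((a ≡ᵇ 0) ∧ (a ≡ᵇ L))) ≡ false
    wrap-irrefl zero    = refl
    wrap-irrefl (suc a) = refl

  isSucc⇒≡ : ∀ {x y} → T (isSucc x y) → suc (toℕ x) ≡ toℕ y
  isSucc⇒≡ {x} {y} = ≡ᵇ⇒≡ (suc (toℕ x)) (toℕ y)

  isSucc-asym : ∀ x y → T (isSucc x y) → isSucc y x ≡ false
  isSucc-asym x y x→y = ≡ᵇ-false λ y+1≡x → 2+n≢n (trans (cong suc (isSucc⇒≡ {x} {y} x→y)) y+1≡x)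
    where
    2+n≢n : ∀ {a} → suc (suc a) ≢ a
    2+n≢n {suc a} = 2+n≢n ∘ suc-injective

  edgeClass-sym : ∀ x y → edgeClass x y ≡ edgeClass y x
  edgeClass-sym x y with isSucc x y in x→y | isSucc y x in y→x
  ... | true  | true  = ⊥-elim (subst T (isSucc-asym x y (Equivalence.from T-≡ x→y)) (Equivalence.from T-≡ y→x))
  ... | true  | false = refl
  ... | false | true  = refl
  ... | false | false = refl

  isSucc⇒¬isWrap : ∀ x y → T (isSucc x y) → isWrap x y ≡ false
  isSucc⇒¬isWrap x y x→y rewrite sym (isSucc⇒≡ {x} {y} x→y) = wrap-succ (toℕ x)
    where
    wrap-succ : ∀ a → (((a ≡ᵇ 0) ∧ (suc a ≡ᵇ L)) ∨ ((suc a ≡ᵇ 0) ∧ (a ≡ᵇ L))) ≡ false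
    wrap-succ zero    = refl
    wrap-succ (suc a) = refl

  cut-succ : ∀ c x y → T (isSucc x y) → x ≢ c → (cut c x xor cut c y) ≡ isWrap x y
  cut-succ c x y x→y x≢c = begin
    (toℕ x ≤ᵇ toℕ c) xor (toℕ y ≤ᵇ toℕ c)
      ≡⟨ cong (λ b → (toℕ x ≤ᵇ toℕ c) xor (b ≤ᵇ toℕ c)) (isSucc⇒≡ {x} {y} x→y) ⟨
    (toℕ x ≤ᵇ toℕ c) xor (suc (toℕ x) ≤ᵇ toℕ c) ≡⟨ ≤ᵇ-xor-suc (toℕ x) (toℕ c) ⟩
    toℕ x ≡ᵇ toℕ c                              ≡⟨ ≡ᵇ-false (x≢c ∘ toℕ-injective) ⟩
    false                                        ≡⟨ isSucc⇒¬isWrap x y x→y ⟨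
    isWrap x y                                   ∎
    where open ≡-Reasoning

  cut-wrap : ∀ c x y → T (isWrap₀ x y) → fromℕ L ≢ c → (cut c x xor cut c y) ≡ true
  cut-wrap c x y wrap L≢c with Equivalence.to (T-∧ {toℕ x ≡ᵇ 0}) wrap
  ... | x≡0 , y≡L rewrite ≡ᵇ⇒≡ (toℕ x) 0 x≡0 | ≡ᵇ⇒≡ (toℕ y) L y≡L = cong not (≤ᵇ-false c<L)
    where
    c<L : toℕ c < L
    c<L = ≤∧≢⇒< (toℕ≤pred[n] c) λ c≡L → L≢c (toℕ-injective (trans (toℕ-fromℕ L) (sym c≡L)))

  -- cut c is the arc {0, …, c}: its boundary consists of the edge of class c and the closing edge.
  cut-coboundary : ∀ c x y → T (cycle x y) → edgeClass x y ≢ c → (cut c x xor cut c y) ≡ isWrap x y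
  cut-coboundary c x y xy class≢c with isSucc x y in x→y
  ... | true = cut-succ c x y (Equivalence.from T-≡ x→y) class≢c
  ... | false with isSucc y x in y→x
  ...   | true = trans (xor-comm (cut c x) (cut c y))
                   (trans (cut-succ c y x (Equivalence.from T-≡ y→x) class≢c) (isWrap-sym y x))
  ...   | false with Equivalence.to (T-∨ {isWrap₀ x y}) xy
  ...     | inj₁ wrap = trans (cut-wrap c x y wrap class≢c) (sym (Equivalence.to T-≡ xy))
  ...     | inj₂ wrap = trans (xor-comm (cut c x) (cut c y)) (trans (cut-wrap c y x wrap class≢c) (sym (Equivalence.to T-≡ xy)))

  open TwoLift cycle cycle-sym cycle-irrefl

  untwisted : Fin (suc L) → Fin (suc L) → Bool
  untwisted _ _ = false

  twoCycles : Graph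
  twoCycles = lift untwisted

  doubleCycle : Graph
  doubleCycle = lift isWrap

  switching : Switching twoCycles doubleCycle
  switching = lift-switching {σ = untwisted} (λ _ _ → refl) isWrap-sym edgeClass edgeClass-sym cut cut-coboundary

  zeroInSheet : Bool → NV twoCycles
  zeroInSheet s = v₀ , adj⇒hasNbr twoCycles {v₀} v₁ v₀~v₁
    where
    v₀ = unsplit (inSheet s fzero)
    v₁ = unsplit (inSheet s (fsuc fzero))
    v₀~v₁ : T (adj twoCycles v₀ v₁)
    v₀~v₁ = subst T (sym (trans (adj-lift-unsplit untwisted (λ _ _ → refl) (inSheet s fzero) (inSheet s (fsuc fzero)))
                                   (liftAdj-inSheet untwisted s fzero (fsuc fzero)))) _

  sheet-twoCycles : ∀ i j → T (adj twoCycles i j) → sheet (split i) ≡ sheet (split j)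
  sheet-twoCycles i j ij = sheet-untwisted (split i) (split j) (subst T (adj-lift untwisted (λ _ _ → refl) i j) ij)

  twoCycles-disconnected : ¬ AllReachable twoCycles
  twoCycles-disconnected allReach
    with trans (cong sheet (sym (split-unsplit (inj₁ fzero))))
           (trans (Reach-invariant (sheet ∘ split) sheet-twoCycles (allReach (zeroInSheet false) (zeroInSheet true)))
                  (cong sheet (split-unsplit (inj₂ fzero))))
  ... | ()

  descend : ∀ s x y → toℕ x ≡ suc (toℕ y) → T (adj doubleCycle (unsplit (inSheet s x)) (unsplit (inSheet s y)))
  descend s x y x≡y+1 =
    subst T (sym (trans (adj-lift-unsplit isWrap isWrap-sym (inSheet s x) (inSheet s y)) (liftAdj-inSheet isWrap s x y)))
    (Equivalence.from (T-∧ {cycle x y})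
      ( Equivalence.from (T-∨ {isSucc x y}) (inj₂ (Equivalence.from (T-∨ {isSucc y x}) (inj₁ y→x)))
      , Equivalence.from T-not-≡ (trans (isWrap-sym x y) (isSucc⇒¬isWrap y x y→x))))
    where
    y→x : T (isSucc y x)
    y→x = ≡⇒≡ᵇ _ _ (sym x≡y+1)

  hub : Fin (suc L + suc L)
  hub = unsplit (inj₁ fzero)

  descendToZero : ∀ s j x → toℕ x ≡ j → Reach doubleCycle (unsplit (inSheet s x)) (unsplit (inSheet s fzero))
  descendToZero s zero    x x≡0 rewrite toℕ-injective {j = fzero} x≡0 = here
  descendToZero s (suc j) x x≡j+1 =
    step (descend s x y (trans x≡j+1 (cong suc (sym (toℕ-fromℕ< j<))))) (descendToZero s j y (toℕ-fromℕ< j<))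
    where
    j< : j < suc L
    j< = <-trans (n<1+n j) (subst (_< suc L) x≡j+1 (toℕ<n x))
    y = fromℕ< j<

  crossing : T (adj doubleCycle (unsplit (inj₂ fzero)) (unsplit (inj₁ (fromℕ L))))
  crossing = subst T (sym (adj-lift-unsplit isWrap isWrap-sym (inj₂ fzero) (inj₁ (fromℕ L)))) closing
    where
    closing : T (liftAdj isWrap (inj₂ fzero) (inj₁ (fromℕ L)))
    closing rewrite toℕ-fromℕ k | ≡ᵇ-refl k = _

  reachHub : ∀ u → Reach doubleCycle (unsplit u) hub
  reachHub (inj₁ x) = descendToZero false (toℕ x) x refl
  reachHub (inj₂ x) = Reach-trans (descendToZero true (toℕ x) x refl)
    (step crossing (descendToZero false L (fromℕ L) (toℕ-fromℕ L)))

  doubleCycle-connected : AllReachable doubleCycle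
  doubleCycle-connected (i , _) (j , _) = Reach-trans (toHub i) (Reach-sym (toHub j))
    where
    toHub : ∀ i → Reach doubleCycle i hub
    toHub i = subst (λ z → Reach doubleCycle z hub) (join-splitAt (suc L) (suc L) i) (reachHub (split i))

  twoCycles≇doubleCycle : ¬ (twoCycles ≅ doubleCycle)
  twoCycles≇doubleCycle iso = twoCycles-disconnected (AllReachable-≅ iso doubleCycle-connected)

-- Edge bounds

≤-by-evaluation : ∀ {m n} → True (m ≤? n) → m ≤ n
≤-by-evaluation = toWitness

length-concatMap-≤ : ∀ {A B : Set} (f : A → List B) k (xs : List A) →
  (∀ x → length (f x) ≤ k) → length (concatMap f xs) ≤ length xs * k
length-concatMap-≤ f k []       _  = z≤n
length-concatMap-≤ f k (x ∷ xs) fk rewrite length-++ (f x) {concatMap f xs} =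
  +-mono-≤ (fk x) (length-concatMap-≤ f k xs fk)

numEdges≤n² : ∀ H → numEdges H ≤ n H * n H
numEdges≤n² H = ≤-trans (length-concatMap-≤ _ (n H) (allFin (n H)) row≤n)
  (≤-reflexive (cong (_* n H) (length-tabulate {n = n H} (λ i → i))))
  where
  singleton≤1 : ∀ {B : Set} b (p : B) → length (if b then [ p ] else []) ≤ 1
  singleton≤1 true  p = s≤s z≤n
  singleton≤1 false p = z≤n
  row≤n : ∀ i → length (concatMap (λ j → if isEdge H i j then [ (i , j) ] else []) (allFin (n H))) ≤ n H
  row≤n i = ≤-trans (length-concatMap-≤ _ 1 (allFin (n H)) (λ j → singleton≤1 (isEdge H i j) (i , j)))
    (≤-reflexive (trans (*-identityʳ _) (length-tabulate {n = n H} (λ j → j))))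

4d+5≤2^d : ∀ t → 4 * (5 + t) + 5 ≤ 2 ^ (5 + t)
4d+5≤2^d zero    = ≤-by-evaluation _
4d+5≤2^d (suc t) = begin
  4 * (5 + suc t) + 5               ≡⟨ step-identity t ⟩
  (4 * (5 + t) + 5) + 4             ≤⟨ +-mono-≤ (4d+5≤2^d t) (≤-trans 4≤ (4d+5≤2^d t)) ⟩
  2 ^ (5 + t) + 2 ^ (5 + t)         ≡⟨ cong (2 ^ (5 + t) +_) (+-identityʳ (2 ^ (5 + t))) ⟨
  2 ^ (5 + suc t)                   ∎
  where
  open ≤-Reasoning
  4≤ : 4 ≤ 4 * (5 + t) + 5
  4≤ = ≤-trans (n≤1+n 4) (m≤n+m 5 (4 * (5 + t)))
  step-identity : ∀ t → 4 * (5 + suc t) + 5 ≡ (4 * (5 + t) + 5) + 4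
  step-identity = solve-∀

lift-square-bound : ∀ t → let d = 5 + t in (suc d + suc d) * (suc d + suc d) ≤ (d + 1) * (2 ^ d ∸ 1)
lift-square-bound t = begin
  (suc d + suc d) * (suc d + suc d) ≡⟨ square-identity d ⟩
  (d + 1) * (4 * (d + 1))           ≤⟨ *-monoʳ-≤ (d + 1) (m+n≤o⇒m≤o∸n (4 * (d + 1))
                                         (≤-trans (≤-reflexive (linear-identity d)) (4d+5≤2^d t))) ⟩
  (d + 1) * (2 ^ d ∸ 1)             ∎
  where
  open ≤-Reasoning
  d = 5 + t
  square-identity : ∀ d → (suc d + suc d) * (suc d + suc d) ≡ (d + 1) * (4 * (d + 1))
  square-identity = solve-∀
  linear-identity : ∀ d → 4 * (d + 1) + 1 ≡ 4 * d + 5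
  linear-identity = solve-∀

module TwoEdges where

  pattern v₀ = fzero
  pattern v₁ = fsuc fzero
  pattern v₂ = fsuc (fsuc fzero)
  pattern v₃ = fsuc (fsuc (fsuc fzero))

  twoK₂ : Graph
  twoK₂ = graph 4 λ where
    v₀ v₁ → true
    v₂ v₃ → true
    _  _  → false

  path₃ : Graph
  path₃ = graph 4 λ where
    v₀ v₁ → true
    v₁ v₂ → true
    _  _  → false

  classK : Fin 4 → Fin 4 → Fin 2
  classK v₂ v₃ = fsuc fzero
  classK v₃ v₂ = fsuc fzero
  classK _  _  = fzero

  classP : Fin 4 → Fin 4 → Fin 2
  classP v₁ v₂ = fsuc fzero
  classP v₂ v₁ = fsuc fzero
  classP _  _  = fzero

  -- Without its class-0 edge, twoK₂ is the edge v₂v₃, sent onto v₁v₂; without its class-1 edge it is v₀v₁, kept fixed.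
  switchK unswitchK : Fin 2 → Fin 4 → Fin 4
  switchK fzero v₀ = v₀
  switchK fzero v₁ = v₃
  switchK fzero v₂ = v₁
  switchK fzero v₃ = v₂
  switchK (fsuc fzero) x = x
  unswitchK fzero v₀ = v₀
  unswitchK fzero v₃ = v₁
  unswitchK fzero v₁ = v₂
  unswitchK fzero v₂ = v₃
  unswitchK (fsuc fzero) x = x

  switching : Switching twoK₂ path₃
  switching = record
    { classes = 2 ; classX = classK ; classY = classP
    ; classX-sym = toWitness {a? = all? λ u → all? λ v → classK u v ≟ classK v u} _
    ; classY-sym = toWitness {a? = all? λ u → all? λ v → classP u v ≟ classP v u} _
    ; switch = switchK ; unswitch = unswitchK
    ; switch-unswitch = toWitness {a? = all? λ c → all? λ y → switchK c (unswitchK c y) ≟ y} _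
    ; unswitch-switch = toWitness {a? = all? λ c → all? λ x → unswitchK c (switchK c x) ≟ x} _
    ; switch-adj = toWitness {a? = all? λ c → all? λ u → all? λ v →
        T? (adj twoK₂ u v) →-dec ¬? (classK u v ≟ c) →-dec T? (adj path₃ (switchK c u) (switchK c v))} _
    ; switch-class = toWitness {a? = all? λ c → all? λ u → all? λ v →
        T? (adj twoK₂ u v) →-dec ¬? (classK u v ≟ c) →-dec (classP (switchK c u) (switchK c v) ≟ classK u v)} _
    ; unswitch-adj = toWitness {a? = all? λ c → all? λ u → all? λ v →
        T? (adj path₃ u v) →-dec ¬? (classP u v ≟ c) →-dec T? (adj twoK₂ (unswitchK c u) (unswitchK c v))} _
    ; unswitch-class = toWitness {a? = all? λ c → all? λ u → all? λ v →
        T? (adj path₃ u v) →-dec ¬? (classP u v ≟ c) →-dec (classK (unswitchK c u) (unswitchK c v) ≟ classP u v)} _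
    }

  path₃-connected : AllReachable path₃
  path₃-connected a b = Reach-trans (toMiddle a) (Reach-sym (toMiddle b))
    where
    toMiddle : ∀ (a : NV path₃) → Reach path₃ (proj₁ a) v₁
    toMiddle (v₀ , _) = step _ here
    toMiddle (v₁ , _) = here
    toMiddle (v₂ , _) = step _ here
    toMiddle (v₃ , ())

  twoK₂-disconnected : ¬ AllReachable twoK₂
  twoK₂-disconnected allReach with Reach-invariant (λ i → toℕ i <ᵇ 2)
    (toWitness {a? = all? λ u → all? λ v → T? (adj twoK₂ u v) →-dec ((toℕ u <ᵇ 2) ≟ᵇ (toℕ v <ᵇ 2))} _)
    (allReach (v₀ , _) (v₂ , _))
  ... | ()

  twoK₂≇path₃ : ¬ (twoK₂ ≅ path₃)
  twoK₂≇path₃ iso = twoK₂-disconnected (AllReachable-≅ iso path₃-connected)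

Connected⇒vertex : ∀ G → Connected G → Fin (n G)
Connected⇒vertex (graph zero    _) (() , _)
Connected⇒vertex (graph (suc _) _) _ = fzero

-- |E| ≤ |V|² suffices from d = 5 on; for d = 2, 3, 4 the edges are counted by evaluation.
cycleLifts-bound : ∀ k → let d = suc (suc k) in
  numEdges (Cycle.twoCycles k) ≤ (d + 1) * (2 ^ d ∸ 1) × numEdges (Cycle.doubleCycle k) ≤ (d + 1) * (2 ^ d ∸ 1)
cycleLifts-bound 0 = ≤-by-evaluation _ , ≤-by-evaluation _
cycleLifts-bound 1 = ≤-by-evaluation _ , ≤-by-evaluation _
cycleLifts-bound 2 = ≤-by-evaluation _ , ≤-by-evaluation _
cycleLifts-bound (suc (suc (suc t))) =
  ≤-trans (numEdges≤n² (Cycle.twoCycles (3 + t))) (lift-square-bound t) ,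
  ≤-trans (numEdges≤n² (Cycle.doubleCycle (3 + t))) (lift-square-bound t)

theorem20 : (d : ℕ) → 1 ≤ d →
    Σ Graph λ T → Σ Graph λ U →
    numEdges T ≤ (d + 1) * (2 ^ d ∸ 1) ×
    numEdges U ≤ (d + 1) * (2 ^ d ∸ 1) ×
    ¬ (T ≅ U) ×
    (∀ (G : Graph) → Connected G → numEdges G ≤ d →
    ∃ λ k → ICount G T k × ICount G U k)
theorem20 zero ()
theorem20 (suc zero) _ =
  twoK₂ , path₃ , ≤-by-evaluation _ , ≤-by-evaluation _ , twoK₂≇path₃ ,
  λ G connected few → switching⇒sameCount switching G (Connected⇒vertex G connected) (s≤s few)
  where open TwoEdges
theorem20 (suc (suc k)) _ =
  twoCycles , doubleCycle , proj₁ (cycleLifts-bound k) , proj₂ (cycleLifts-bound k) , twoCycles≇doubleCycle ,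
  λ G connected few → switching⇒sameCount switching G (Connected⇒vertex G connected) (s≤s few)
  where open Cycle k
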